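{- For any $p\in(0,1)$, $\mu>0$ and integers $k\geq3$, $1\le \ell\le k-2$, $m\ge 2$, there exist $n_0$ and $\alpha>0$ such that for all $n\geq n_0$ there exists a $(p,\mu)$-dense $k$-partite $k$-graph $H$ with each part having $n$ vertices such that $\delta'_\ell(H)\ge \alpha n^{k-\ell}$ and $H$ has no $K_k(m)$-factor.
   Context: A $k$-graph has edges that are $k$-element subsets of its vertex set. A $k$-graph $H$ is $k$-partite with parts $V_1,\dots,V_k$ (a partition of $V(H)$) if every edge meets each $V_i$ in at most one vertex. A set $S$ is legal if $|S\cap V_i|\le1$ for all $i$. For $1\le s\le k-1$ and a legal $s$-set $S$, $\deg_H(S)$ is the number of $(k-s)$-sets $S'$ with $S\cup S'\in E(H)$, and $\delta'_s(H)$ is the minimum of $\deg_H(S)$ over all legal $s$-sets $S$. For $0<p,\mu<1$, $H$ with $N=|V(H)|$ vertices is $(p,\mu)$-dense if for all $X_1\subseteq V_1,\dots,X_k\subseteq V_k$, $e_H(X_1,\dots,X_k)\ge p|X_1|\cdots|X_k|-\mu N^k$, where $e_H(X_1,\dots,X_k)$ counts $(x_1,\dots,x_k)\in X_1\times\cdots\times X_k$ with $\{x_1,\dots,x_k\}\in E(H)$. $K_k(m)$ is the complete $k$-partite $k$-graph with each part having $m$ vertices. An $F$-factor is a set of vertex-disjoint copies of $F$ covering all vertices.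
   Formalization: The parameters p and μ range over the rationals, and the witness α is likewise taken in the rationals. -}

module Defs where

open import Data.Nat using (ℕ; zero; suc; _*_; _^_; _∸_)
open import Data.Integer using (+_)
open import Data.Rational using (ℚ; _/_)
import Data.Rational as Q
open import Data.Bool using (Bool; true; false; _∧_; _∨_; not)
open import Data.Fin using (Fin; zero; suc)
import Data.Fin as F
open import Data.Fin.Subset using (Subset; ∣_∣)
open import Data.Vec using (lookup)
open import Data.List using (List; []; _∷_; map; concatMap; filterᵇ; length; allFin)
open import Data.Bool.ListAction using (all)
open import Data.Nat.ListAction using (product)
open import Data.Product using (Σ; ∃; _×_; _,_)
open import Relation.Binary.PropositionalEquality using (_≡_)
open import Relation.Nullary using (¬_)
open import Relation.Nullary.Decidable using (⌊_⌋)

toℚ : ℕ → ℚ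
toℚ n = + n / 1

consF : ∀ {k n} → Fin n → (Fin k → Fin n) → Fin (suc k) → Fin n
consF a f zero = a
consF a f (suc i) = f i

allFuns : (k n : ℕ) → List (Fin k → Fin n)
allFuns zero n = (λ ()) ∷ []
allFuns (suc k) n = concatMap (λ f → map (λ a → consF a f) (allFin n)) (allFuns k n)

count : ∀ {k n} → ((Fin k → Fin n) → Bool) → ℕ
count {k} {n} P = length (filterᵇ P (allFuns k n))

-- A k-partite k-graph with parts V_i = {i} × Fin n (i : Fin k), each of size n.
-- Vertices are pairs (i , v) : Fin k × Fin n. Since every edge is a k-set meeting
-- each part in at most one vertex, it meets each part in exactly one vertex, so
-- an edge is determined by a function e : Fin k → Fin n (e i = its vertex in V_i).
PartiteGraph : ℕ → ℕ → Set
PartiteGraph k n = (Fin k → Fin n) → Bool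

eH : ∀ {k n} → PartiteGraph k n → (Fin k → Subset n) → ℕ
eH {k} H X = count (λ e → H e ∧ all (λ i → lookup (X i) (e i)) (allFin k))

-- (p, μ)-dense, with N = |V(H)| = k * n
Dense : ∀ {k n} → ℚ → ℚ → PartiteGraph k n → Set
Dense {k} {n} p μ H = (X : Fin k → Subset n) →
  (p Q.* toℚ (product (map (λ i → ∣ X i ∣) (allFin k)))) Q.- (μ Q.* toℚ ((k * n) ^ k))
    Q.≤ toℚ (eH H X)

-- A legal s-set S is given by the set I ⊆ [k] of parts it meets (|I| = s)
-- together with f : Fin k → Fin n, S = {(i , f i) | i ∈ I} (f outside I irrelevant).
-- deg_H(S) = number of (k-s)-sets S' with S ∪ S' ∈ E(H) = number of edges e
-- agreeing with f on I.
deg : ∀ {k n} → PartiteGraph k n → Subset k → (Fin k → Fin n) → ℕ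
deg {k} H I f = count (λ e → H e ∧ all (λ i → not (lookup I i) ∨ ⌊ e i F.≟ f i ⌋) (allFin k))

MinCodegAtLeast : ∀ {k n} → ℕ → ℚ → PartiteGraph k n → Set
MinCodegAtLeast {k} {n} s d H =
  (I : Subset k) → ∣ I ∣ ≡ s → (f : Fin k → Fin n) → d Q.≤ toℚ (deg H I f)

IsEdge : ∀ {k n} → PartiteGraph k n → (Fin k → Fin k × Fin n) → Set
IsEdge {k} {n} H v = Σ (Fin k → Fin n) λ e → (H e ≡ true)
  × ((j : Fin k) → ∃ λ i → v i ≡ (j , e j))
  × ((i : Fin k) → ∃ λ j → v i ≡ (j , e j))

-- a copy of K_k(m) in H: a map from V(K_k(m)) = Fin k × Fin m into V(H)
-- (injectivity is imposed globally in the factor) sending every edge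
-- {(0,a 0),...,(k-1,a(k-1))} of K_k(m) onto an edge of H
IsCopyOfK : ∀ {k n} → (m : ℕ) → PartiteGraph k n → (Fin k × Fin m → Fin k × Fin n) → Set
IsCopyOfK {k} m H φ = (a : Fin k → Fin m) → IsEdge H (λ i → φ (i , a i))

-- K_k(m)-factor: copies φ_t (t : Fin r) that are injective, pairwise vertex-disjoint
-- (together: the combined map is injective) and cover all vertices (surjective)
HasKFactor : ∀ {k n} → (m : ℕ) → PartiteGraph k n → Set
HasKFactor {k} {n} m H = Σ ℕ λ r → Σ (Fin r → Fin k × Fin m → Fin k × Fin n) λ φ →
    ((t : Fin r) → IsCopyOfK m H (φ t))
  × ((t t' : Fin r) (u u' : Fin k × Fin m) → φ t u ≡ φ t' u' → (t ≡ t') × (u ≡ u'))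
  × ((w : Fin k × Fin n) → Σ (Fin r) λ t → ∃ λ u → φ t u ≡ w)

{-# OPTIONS --safe #-}
module Submission where

-- The witness is a space barrier. Let d be the denominator of μ (so μ ≥ 1/d), c = k d and
-- b = ⌊n / c⌋. Take A ⊆ V₁ of size a = (k-1) b + 1 and B ⊆ V₂ ∪ ⋯ ∪ V_k consisting of b
-- vertices from each part, and let every transversal be an edge except those that meet A
-- and avoid B.
-- Every non-edge meets A, so there are at most a n^(k-1) ≤ n^k / d ≤ μ (kn)^k of them,
-- which gives (p, μ)-density for every p ≤ 1. A legal ℓ-set with ℓ ≤ k - 2 misses some
-- part V_j with j ≥ 2, so all b^(k-ℓ) transversals through it that take one of the first
-- b vertices of every free part meet B and are edges; and b ≥ n / 2c.
-- A copy of K_k(m) through a vertex of A has a whole vertex class inside B: otherwise a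
-- transversal of the copy through that vertex avoids B. In a K_k(m)-factor this sends each
-- vertex of A to a vertex of B, injectively, contradicting |A| > |B|.

open import Defs

module Counting where

  open import Data.Bool using (Bool; true; false; T; _∧_; not; if_then_else_)
  open import Data.Bool.ListAction using (all; and)
  open import Data.Empty using (⊥-elim)
  open import Data.Fin using (Fin; zero; suc; toℕ; _≟_)
  open import Data.Fin.Properties using (suc-injective)
  open import Data.Fin.Subset using (Subset; ∣_∣)
  open import Data.Fin.Subset.Properties using (∣p∣≤n)
  open import Data.List using (List; []; _∷_; map; concatMap; filterᵇ; length; allFin; _++_)
  open import Data.List.Properties using (map-∘; map-cong; map-++; map-tabulate)
  open import Data.Nat using (ℕ; zero; suc; _+_; _*_; _^_; _∸_; _≤_; _<_; _<ᵇ_; z≤n; s≤s)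
  open import Data.Nat.ListAction using (sum; product)
  open import Data.Nat.ListAction.Properties using (sum-++)
  open import Data.Nat.Properties
    using (+-identityʳ; *-zeroʳ; *-comm; *-distribˡ-+; +-mono-≤; ≤-refl; +-∸-assoc; +-commutativeSemigroup; module ≤-Reasoning)
  open import Algebra.Properties.CommutativeSemigroup +-commutativeSemigroup using (interchange)
  open import Data.Product using (∃; _,_)
  open import Data.Vec using (lookup; []; _∷_)
  open import Function using (_∘_; id)
  open import Relation.Binary.PropositionalEquality
  open import Relation.Nullary.Decidable using (⌊_⌋; ⌊⌋-map′)

  private
    variable
      A B : Set
      k n : ℕ

  iverson : Bool → ℕ
  iverson true = 1
  iverson false = 0

  tally : (A → Bool) → List A → ℕ
  tally P xs = sum (map (iverson ∘ P) xs)

  count≡tally : (P : (Fin k → Fin n) → Bool) → count P ≡ tally P (allFuns k n)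
  count≡tally {k} {n} P = go (allFuns k n)
    where
    go : ∀ xs → length (filterᵇ P xs) ≡ tally P xs
    go [] = refl
    go (x ∷ xs) with P x
    ... | true = cong suc (go xs)
    ... | false = go xs

  iverson-∧ : ∀ a b → iverson (a ∧ b) ≡ iverson a * iverson b
  iverson-∧ true b = sym (+-identityʳ (iverson b))
  iverson-∧ false b = refl

  iverson-mono : ∀ {a b} → (T a → T b) → iverson a ≤ iverson b
  iverson-mono {false} _ = z≤n
  iverson-mono {true} {true} _ = ≤-refl
  iverson-mono {true} {false} a⇒b = ⊥-elim (a⇒b _)

  sum-map-+ : (f g : A → ℕ) (xs : List A) →
    sum (map (λ x → f x + g x) xs) ≡ sum (map f xs) + sum (map g xs)
  sum-map-+ f g [] = refl
  sum-map-+ f g (x ∷ xs) = begin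
    (f x + g x) + sum (map (λ x → f x + g x) xs)
      ≡⟨ cong ((f x + g x) +_) (sum-map-+ f g xs) ⟩
    (f x + g x) + (sum (map f xs) + sum (map g xs))
      ≡⟨ interchange (f x) (g x) _ _ ⟩
    (f x + sum (map f xs)) + (g x + sum (map g xs)) ∎
    where
    open ≡-Reasoning

  sum-map-*ˡ : (c : ℕ) (f : A → ℕ) (xs : List A) → sum (map (λ x → c * f x) xs) ≡ c * sum (map f xs)
  sum-map-*ˡ c f [] = sym (*-zeroʳ c)
  sum-map-*ˡ c f (x ∷ xs) = trans (cong (c * f x +_) (sum-map-*ˡ c f xs)) (sym (*-distribˡ-+ c (f x) _))

  sum-map-mono : {f g : A → ℕ} → (∀ x → f x ≤ g x) → (xs : List A) → sum (map f xs) ≤ sum (map g xs)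
  sum-map-mono f≤g [] = z≤n
  sum-map-mono f≤g (x ∷ xs) = +-mono-≤ (f≤g x) (sum-map-mono f≤g xs)

  tally-map : (P : B → Bool) (g : A → B) (xs : List A) → tally P (map g xs) ≡ tally (P ∘ g) xs
  tally-map P g xs = cong sum (sym (map-∘ xs))

  tally-concatMap : (P : B → Bool) (G : A → List B) (xs : List A) →
    tally P (concatMap G xs) ≡ sum (map (tally P ∘ G) xs)
  tally-concatMap P G [] = refl
  tally-concatMap P G (x ∷ xs) = begin
    sum (map (iverson ∘ P) (G x ++ concatMap G xs))
      ≡⟨ cong sum (map-++ (iverson ∘ P) (G x) _) ⟩
    sum (map (iverson ∘ P) (G x) ++ map (iverson ∘ P) (concatMap G xs))
      ≡⟨ sum-++ (map (iverson ∘ P) (G x)) _ ⟩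
    tally P (G x) + tally P (concatMap G xs)
      ≡⟨ cong (tally P (G x) +_) (tally-concatMap P G xs) ⟩
    sum (map (tally P ∘ G) (x ∷ xs)) ∎
    where open ≡-Reasoning

  map-allFin-suc : (f : Fin (suc n) → A) → map f (allFin (suc n)) ≡ f zero ∷ map (f ∘ suc) (allFin n)
  map-allFin-suc f = cong (f zero ∷_) (trans (map-tabulate suc f) (sym (map-tabulate id (f ∘ suc))))

  tally-allFin-suc : (Q : Fin (suc n) → Bool) →
    tally Q (allFin (suc n)) ≡ iverson (Q zero) + tally (Q ∘ suc) (allFin n)
  tally-allFin-suc Q = cong sum (map-allFin-suc (iverson ∘ Q))

  tally-lookup : (S : Subset n) → tally (lookup S) (allFin n) ≡ ∣ S ∣
  tally-lookup [] = refl
  tally-lookup (true ∷ S) = trans (tally-allFin-suc (lookup (true ∷ S))) (cong suc (tally-lookup S))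
  tally-lookup (false ∷ S) = trans (tally-allFin-suc (lookup (false ∷ S))) (tally-lookup S)

  tally-true : ∀ n → tally (λ (_ : Fin n) → true) (allFin n) ≡ n
  tally-true zero = refl
  tally-true (suc n) = trans (tally-allFin-suc {n} (λ _ → true)) (cong suc (tally-true n))

  tally-false : ∀ n → tally (λ (_ : Fin n) → false) (allFin n) ≡ 0
  tally-false zero = refl
  tally-false (suc n) = trans (tally-allFin-suc {n} (λ _ → false)) (tally-false n)

  tally-<ᵇ : ∀ {t} → t ≤ n → tally (λ (v : Fin n) → toℕ v <ᵇ t) (allFin n) ≡ t
  tally-<ᵇ {n} {zero} _ = tally-false n
  tally-<ᵇ {suc n} {suc t} (s≤s t≤n) =
    trans (tally-allFin-suc {n} (λ v → toℕ v <ᵇ suc t)) (cong suc (tally-<ᵇ t≤n))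

  tally-≟ : (a : Fin n) → tally (λ v → ⌊ v ≟ a ⌋) (allFin n) ≡ 1
  tally-≟ {suc n} zero = trans (tally-allFin-suc {n} (λ v → ⌊ v ≟ zero ⌋)) (cong suc (tally-false n))
  -- ⌊ suc v ≟ suc a ⌋ does not reduce to ⌊ v ≟ a ⌋: Fin's _≟_ goes through map′.
  tally-≟ {suc n} (suc a) = begin
    tally (λ v → ⌊ v ≟ suc a ⌋) (allFin (suc n))
      ≡⟨ tally-allFin-suc {n} (λ v → ⌊ v ≟ suc a ⌋) ⟩
    tally (λ v → ⌊ suc v ≟ suc a ⌋) (allFin n)
      ≡⟨ cong sum (map-cong (λ v → cong iverson (⌊⌋-map′ (cong suc) suc-injective (v ≟ a))) (allFin n)) ⟩
    tally (λ v → ⌊ v ≟ a ⌋) (allFin n)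
      ≡⟨ tally-≟ a ⟩
    1 ∎
    where open ≡-Reasoning

  count-cong : {P Q : (Fin k → Fin n) → Bool} → (∀ e → P e ≡ Q e) → count P ≡ count Q
  count-cong {k} {n} {P} {Q} P≡Q = begin
    count P                 ≡⟨ count≡tally P ⟩
    tally P (allFuns k n)   ≡⟨ cong sum (map-cong (cong iverson ∘ P≡Q) (allFuns k n)) ⟩
    tally Q (allFuns k n)   ≡⟨ count≡tally Q ⟨
    count Q                 ∎
    where open ≡-Reasoning

  count-mono : {P Q : (Fin k → Fin n) → Bool} → (∀ e → T (P e) → T (Q e)) → count P ≤ count Q
  count-mono {k} {n} {P} {Q} P⇒Q = begin
    count P                 ≡⟨ count≡tally P ⟩
    tally P (allFuns k n)   ≤⟨ sum-map-mono (λ e → iverson-mono (P⇒Q e)) (allFuns k n) ⟩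
    tally Q (allFuns k n)   ≡⟨ count≡tally Q ⟨
    count Q                 ∎
    where open ≤-Reasoning

  count-split : (H P : (Fin k → Fin n) → Bool) →
    count P ≡ count (λ e → H e ∧ P e) + count (λ e → not (H e) ∧ P e)
  count-split {k} {n} H P = begin
    count P
      ≡⟨ count≡tally P ⟩
    tally P (allFuns k n)
      ≡⟨ cong sum (map-cong (λ e → split (H e) (P e)) (allFuns k n)) ⟩
    sum (map (λ e → iverson (H e ∧ P e) + iverson (not (H e) ∧ P e)) (allFuns k n))
      ≡⟨ sum-map-+ (λ e → iverson (H e ∧ P e)) (λ e → iverson (not (H e) ∧ P e)) (allFuns k n) ⟩
    tally (λ e → H e ∧ P e) (allFuns k n) + tally (λ e → not (H e) ∧ P e) (allFuns k n)
      ≡⟨ cong₂ _+_ (count≡tally (λ e → H e ∧ P e)) (count≡tally (λ e → not (H e) ∧ P e)) ⟨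
    count (λ e → H e ∧ P e) + count (λ e → not (H e) ∧ P e) ∎
    where
    open ≡-Reasoning
    split : ∀ h p → iverson p ≡ iverson (h ∧ p) + iverson (not h ∧ p)
    split true p = sym (+-identityʳ (iverson p))
    split false p = refl

  count-cons-∧ : (Q : Fin n → Bool) (R : (Fin k → Fin n) → Bool) →
    count (λ e → Q (e zero) ∧ R (e ∘ suc)) ≡ tally Q (allFin n) * count R
  count-cons-∧ {n} {k} Q R = begin
    count (λ e → Q (e zero) ∧ R (e ∘ suc))
      ≡⟨ count≡tally (λ e → Q (e zero) ∧ R (e ∘ suc)) ⟩
    tally (λ e → Q (e zero) ∧ R (e ∘ suc)) (concatMap extend (allFuns k n))
      ≡⟨ tally-concatMap (λ e → Q (e zero) ∧ R (e ∘ suc)) extend (allFuns k n) ⟩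
    sum (map (tally (λ e → Q (e zero) ∧ R (e ∘ suc)) ∘ extend) (allFuns k n))
      ≡⟨ cong sum (map-cong fibre (allFuns k n)) ⟩
    sum (map (λ f → tally Q (allFin n) * iverson (R f)) (allFuns k n))
      ≡⟨ sum-map-*ˡ (tally Q (allFin n)) (iverson ∘ R) (allFuns k n) ⟩
    tally Q (allFin n) * tally R (allFuns k n)
      ≡⟨ cong (tally Q (allFin n) *_) (count≡tally R) ⟨
    tally Q (allFin n) * count R ∎
    where
    open ≡-Reasoning
    extend : (Fin k → Fin n) → List (Fin (suc k) → Fin n)
    extend f = map (λ a → consF a f) (allFin n)
    fibre : ∀ f → tally (λ e → Q (e zero) ∧ R (e ∘ suc)) (extend f) ≡ tally Q (allFin n) * iverson (R f)
    fibre f = begin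
      tally (λ e → Q (e zero) ∧ R (e ∘ suc)) (extend f)
        ≡⟨ tally-map (λ e → Q (e zero) ∧ R (e ∘ suc)) (λ a → consF a f) (allFin n) ⟩
      sum (map (λ a → iverson (Q a ∧ R f)) (allFin n))
        ≡⟨ cong sum (map-cong (λ a → trans (iverson-∧ (Q a) (R f)) (*-comm (iverson (Q a)) _)) (allFin n)) ⟩
      sum (map (λ a → iverson (R f) * iverson (Q a)) (allFin n))
        ≡⟨ sum-map-*ˡ (iverson (R f)) (iverson ∘ Q) (allFin n) ⟩
      iverson (R f) * tally Q (allFin n)
        ≡⟨ *-comm (iverson (R f)) _ ⟩
      tally Q (allFin n) * iverson (R f) ∎

  count-true : ∀ k n → count {k} {n} (λ _ → true) ≡ n ^ k
  count-true zero n = refl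
  count-true (suc k) n =
    trans (count-cons-∧ {n} {k} (λ _ → true) (λ _ → true)) (cong₂ _*_ (tally-true n) (count-true k n))

  count-box : (P : Fin k → Fin n → Bool) →
    count (λ e → all (λ i → P i (e i)) (allFin k)) ≡
    product (map (λ i → tally (P i) (allFin n)) (allFin k))
  count-box {zero} P = refl
  count-box {suc k} {n} P = begin
    count (λ e → all (λ i → P i (e i)) (allFin (suc k)))
      ≡⟨ count-cong (λ e → cong and (map-allFin-suc (λ i → P i (e i)))) ⟩
    count (λ e → P zero (e zero) ∧ all (λ i → P (suc i) (e (suc i))) (allFin k))
      ≡⟨ count-cons-∧ (P zero) (λ f → all (λ i → P (suc i) (f i)) (allFin k)) ⟩
    tally (P zero) (allFin n) * count (λ f → all (λ i → P (suc i) (f i)) (allFin k))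
      ≡⟨ cong (tally (P zero) (allFin n) *_) (count-box (P ∘ suc)) ⟩
    tally (P zero) (allFin n) * product (map (λ i → tally (P (suc i)) (allFin n)) (allFin k))
      ≡⟨ cong product (map-allFin-suc (λ i → tally (P i) (allFin n))) ⟨
    product (map (λ i → tally (P i) (allFin n)) (allFin (suc k))) ∎
    where open ≡-Reasoning

  subset-misses : (p : Subset n) → ∣ p ∣ < n → ∃ λ j → lookup p j ≡ false
  subset-misses (true ∷ p) (s≤s ∣p∣<n) with j , pj≡false ← subset-misses p ∣p∣<n = suc j , pj≡false
  subset-misses (false ∷ p) _ = zero , refl

  product-1-or-b : (I : Subset k) (b : ℕ) →
    product (map (λ i → if lookup I i then 1 else b) (allFin k)) ≡ b ^ (k ∸ ∣ I ∣)
  product-1-or-b [] b = refl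
  product-1-or-b (true ∷ I) b =
    trans (cong product (map-allFin-suc (λ i → if lookup (true ∷ I) i then 1 else b)))
          (trans (+-identityʳ _) (product-1-or-b I b))
  product-1-or-b (false ∷ I) b =
    trans (cong product (map-allFin-suc (λ i → if lookup (false ∷ I) i then 1 else b)))
          (trans (cong (b *_) (product-1-or-b I b)) (cong (b ^_) (sym (+-∸-assoc 1 (∣p∣≤n I)))))

module ToℚBounds where

  open import Data.Integer as ℤ using (+_; +[1+_]; +≤+)
  open import Data.Integer.Properties as ℤ using (pos-+; pos-*)
  open import Data.Nat as ℕ using (ℕ; suc)
  open import Data.Nat.Coprimality using (1-coprimeTo; sym)
  open import Data.Nat.Properties as ℕ using ()
  open import Data.Rational
    using (ℚ; mkℚ; 0ℚ; 1ℚ; _<_; _≤_; _+_; _-_; _*_; 1/_; ↧ₙ_; toℚᵘ; *≤*; *<*; NonZero; NonNegative; Positive)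
  open import Data.Rational.Properties
  open import Data.Rational.Unnormalised as ℚᵘ using (mkℚᵘ; *≡*)
  open import Data.Rational.Unnormalised.Properties as ℚᵘ using (module ≃-Reasoning)
  open import Relation.Binary.PropositionalEquality as ≡ using (_≡_; cong; cong₂)
  open import Algebra.Properties.Group +-0-group using (//-rightDividesʳ)

  toℚ≡mkℚ : ∀ n → toℚ n ≡ mkℚ (+ n) 0 (sym (1-coprimeTo n))
  toℚ≡mkℚ n = normalize-coprime (sym (1-coprimeTo n))

  toℚᵘ-toℚ : ∀ n → toℚᵘ (toℚ n) ≡ mkℚᵘ (+ n) 0
  toℚᵘ-toℚ n = cong toℚᵘ (toℚ≡mkℚ n)

  toℚ-nonNeg : ∀ n → NonNegative (toℚ n)
  toℚ-nonNeg n = normalize-nonNeg n 1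

  toℚ-suc-pos : ∀ n → Positive (toℚ (suc n))
  toℚ-suc-pos n = normalize-pos (suc n) 1

  toℚ-suc-nonZero : ∀ n → NonZero (toℚ (suc n))
  toℚ-suc-nonZero n = pos⇒nonZero (toℚ (suc n)) {{toℚ-suc-pos n}}

  toℚ-+ : ∀ m n → toℚ (m ℕ.+ n) ≡ toℚ m + toℚ n
  toℚ-+ m n = toℚᵘ-injective (begin
    toℚᵘ (toℚ (m ℕ.+ n))             ≡⟨ toℚᵘ-toℚ (m ℕ.+ n) ⟩
    mkℚᵘ (+ (m ℕ.+ n)) 0              ≈⟨ *≡* cross ⟩
    mkℚᵘ (+ m) 0 ℚᵘ.+ mkℚᵘ (+ n) 0    ≡⟨ cong₂ ℚᵘ._+_ (toℚᵘ-toℚ m) (toℚᵘ-toℚ n) ⟨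
    toℚᵘ (toℚ m) ℚᵘ.+ toℚᵘ (toℚ n)    ≈⟨ toℚᵘ-homo-+ (toℚ m) (toℚ n) ⟨
    toℚᵘ (toℚ m + toℚ n)              ∎)
    where
    open ≃-Reasoning
    cross : + (m ℕ.+ n) ℤ.* + 1 ≡ (+ m ℤ.* + 1 ℤ.+ + n ℤ.* + 1) ℤ.* + 1
    cross rewrite ℤ.*-identityʳ (+ m) | ℤ.*-identityʳ (+ n) = cong (ℤ._* + 1) (pos-+ m n)

  toℚ-* : ∀ m n → toℚ (m ℕ.* n) ≡ toℚ m * toℚ n
  toℚ-* m n = toℚᵘ-injective (begin
    toℚᵘ (toℚ (m ℕ.* n))             ≡⟨ toℚᵘ-toℚ (m ℕ.* n) ⟩
    mkℚᵘ (+ (m ℕ.* n)) 0              ≈⟨ *≡* (cong (ℤ._* + 1) (pos-* m n)) ⟩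
    mkℚᵘ (+ m) 0 ℚᵘ.* mkℚᵘ (+ n) 0    ≡⟨ cong₂ ℚᵘ._*_ (toℚᵘ-toℚ m) (toℚᵘ-toℚ n) ⟨
    toℚᵘ (toℚ m) ℚᵘ.* toℚᵘ (toℚ n)    ≈⟨ toℚᵘ-homo-* (toℚ m) (toℚ n) ⟨
    toℚᵘ (toℚ m * toℚ n)              ∎)
    where open ≃-Reasoning

  toℚ-mono-≤ : ∀ {m n} → m ℕ.≤ n → toℚ m ≤ toℚ n
  toℚ-mono-≤ {m} {n} m≤n rewrite toℚ≡mkℚ m | toℚ≡mkℚ n =
    *≤* (≡.subst₂ ℤ._≤_ (≡.sym (ℤ.*-identityʳ (+ m))) (≡.sym (ℤ.*-identityʳ (+ n))) (+≤+ m≤n))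

  p*[e+d]-q≤e : ∀ {p q} e d → p ≤ 1ℚ → toℚ d ≤ q → p * toℚ (e ℕ.+ d) - q ≤ toℚ e
  p*[e+d]-q≤e {p} {q} e d p≤1 d≤q = begin
    p * toℚ (e ℕ.+ d) - q       ≤⟨ +-mono-≤ p*x≤x (neg-antimono-≤ d≤q) ⟩
    toℚ (e ℕ.+ d) - toℚ d       ≡⟨ cong (_- toℚ d) (toℚ-+ e d) ⟩
    toℚ e + toℚ d - toℚ d       ≡⟨ //-rightDividesʳ (toℚ d) (toℚ e) ⟩
    toℚ e                       ∎
    where
    open ≤-Reasoning
    p*x≤x : p * toℚ (e ℕ.+ d) ≤ toℚ (e ℕ.+ d)
    p*x≤x = ≤-trans (*-monoʳ-≤-nonNeg (toℚ (e ℕ.+ d)) {{toℚ-nonNeg (e ℕ.+ d)}} p≤1)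
                    (≤-reflexive (*-identityˡ (toℚ (e ℕ.+ d))))

  -- μ ≥ 1 / ↧ μ, as the numerator of a positive μ is at least 1.
  toℚ≤μ*toℚ : ∀ μ {m n} → 0ℚ < μ → m ℕ.* ↧ₙ μ ℕ.≤ n → toℚ m ≤ μ * toℚ n
  toℚ≤μ*toℚ μ@(mkℚ +[1+ a ] b _) {m} {n} _ m*d≤n = toℚᵘ-cancel-≤ (begin
    toℚᵘ (toℚ m)                        ≡⟨ toℚᵘ-toℚ m ⟩
    mkℚᵘ (+ m) 0                         ≤⟨ ℚᵘ.*≤* cross ⟩
    mkℚᵘ +[1+ a ] b ℚᵘ.* mkℚᵘ (+ n) 0    ≡⟨ cong (mkℚᵘ +[1+ a ] b ℚᵘ.*_) (toℚᵘ-toℚ n) ⟨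
    toℚᵘ μ ℚᵘ.* toℚᵘ (toℚ n)             ≃⟨ toℚᵘ-homo-* μ (toℚ n) ⟨
    toℚᵘ (μ * toℚ n)                     ∎)
    where
    open ℚᵘ.≤-Reasoning
    cross : + m ℤ.* + (suc b ℕ.* 1) ℤ.≤ (+[1+ a ] ℤ.* + n) ℤ.* + 1
    cross rewrite ℕ.*-identityʳ (suc b) | ℤ.*-identityʳ (+[1+ a ] ℤ.* + n)
                | ≡.sym (pos-* m (suc b)) | ≡.sym (pos-* (suc a) n) =
      +≤+ (ℕ.≤-trans m*d≤n (ℕ.m≤n*m n (suc a)))
  toℚ≤μ*toℚ (mkℚ (+ 0) _ _) (*<* (ℤ.+<+ ()))
  toℚ≤μ*toℚ (mkℚ ℤ.-[1+ _ ] _ _) (*<* ())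

  1/suc : ℕ → ℚ
  1/suc M = (1/ toℚ (suc M)) {{toℚ-suc-nonZero M}}

  1/suc-positive : ∀ M → Positive (1/suc M)
  1/suc-positive M = 1/pos⇒pos (toℚ (suc M)) {{toℚ-suc-pos M}}

  1/suc-pos : ∀ M → 0ℚ < 1/suc M
  1/suc-pos M = positive⁻¹ (1/suc M) {{1/suc-positive M}}

  1/suc*toℚ≤toℚ : ∀ M {m n} → m ℕ.≤ suc M ℕ.* n → 1/suc M * toℚ m ≤ toℚ n
  1/suc*toℚ≤toℚ M {m} {n} m≤[1+M]n = begin
    1/suc M * toℚ m
      ≤⟨ *-monoˡ-≤-nonNeg (1/suc M) {{pos⇒nonNeg (1/suc M) {{1/suc-positive M}}}} (toℚ-mono-≤ m≤[1+M]n) ⟩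
    1/suc M * toℚ (suc M ℕ.* n)
      ≡⟨ cong (1/suc M *_) (toℚ-* (suc M) n) ⟩
    1/suc M * (toℚ (suc M) * toℚ n)
      ≡⟨ *-assoc (1/suc M) (toℚ (suc M)) (toℚ n) ⟨
    (1/suc M * toℚ (suc M)) * toℚ n
      ≡⟨ cong (_* toℚ n) (*-inverseˡ (toℚ (suc M)) {{toℚ-suc-nonZero M}}) ⟩
    1ℚ * toℚ n
      ≡⟨ *-identityˡ (toℚ n) ⟩
    toℚ n ∎
    where open ≤-Reasoning

module PartiteGraphs where

  open Counting
  open ToℚBounds
  open import Data.Bool using (not; _∧_)
  open import Data.Bool.Properties using (T-∧)
  open import Data.Bool.ListAction using (all)
  open import Data.Fin using (Fin)
  open import Data.Fin.Subset using (Subset; ∣_∣)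
  open import Data.List using (map; allFin)
  open import Data.List.Properties using (map-cong)
  open import Data.Nat using (ℕ; _+_; _*_; _^_; _≤_)
  open import Data.Nat.ListAction using (product)
  open import Data.Nat.Properties using (≤-trans; *-monoˡ-≤)
  open import Data.Product using (_,_; proj₁)
  open import Data.Product.Properties using (,-injective)
  open import Data.Rational as ℚ using (1ℚ; 0ℚ; ↧ₙ_)
  open import Data.Vec using (lookup)
  open import Function using (_∘_; Equivalence)
  open import Relation.Binary.PropositionalEquality

  private
    variable
      k n : ℕ

  box-size≡eH+nonEdges : (H : PartiteGraph k n) (X : Fin k → Subset n) →
    product (map (λ i → ∣ X i ∣) (allFin k)) ≡
    eH H X + count (λ e → not (H e) ∧ all (λ i → lookup (X i) (e i)) (allFin k))
  box-size≡eH+nonEdges {k} {n} H X = begin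
    product (map (λ i → ∣ X i ∣) (allFin k))
      ≡⟨ cong product (map-cong (λ i → tally-lookup (X i)) (allFin k)) ⟨
    product (map (λ i → tally (lookup (X i)) (allFin n)) (allFin k))
      ≡⟨ count-box (λ i → lookup (X i)) ⟨
    count (λ e → all (λ i → lookup (X i) (e i)) (allFin k))
      ≡⟨ count-split H (λ e → all (λ i → lookup (X i) (e i)) (allFin k)) ⟩
    eH H X + count (λ e → not (H e) ∧ all (λ i → lookup (X i) (e i)) (allFin k)) ∎
    where open ≡-Reasoning

  dense-if-fewNonEdges : ∀ {p μ} (H : PartiteGraph k n) → p ℚ.≤ 1ℚ → 0ℚ ℚ.< μ →
    count (not ∘ H) * ↧ₙ μ ≤ (k * n) ^ k → Dense p μ H
  dense-if-fewNonEdges {k} {n} {μ = μ} H p≤1 μ>0 fewNonEdges X rewrite box-size≡eH+nonEdges H X =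
    p*[e+d]-q≤e (eH H X) nonEdgesInBox p≤1
      (toℚ≤μ*toℚ μ {nonEdgesInBox} μ>0 (≤-trans (*-monoˡ-≤ (↧ₙ μ) inBox≤all) fewNonEdges))
    where
    nonEdgesInBox : ℕ
    nonEdgesInBox = count (λ e → not (H e) ∧ all (λ i → lookup (X i) (e i)) (allFin k))
    inBox≤all : nonEdgesInBox ≤ count (not ∘ H)
    inBox≤all = count-mono {k} {n} (λ _ → proj₁ ∘ Equivalence.to T-∧)

  edge-inPart : ∀ {H : PartiteGraph k n} {v} (E : IsEdge H v) i {j x} → v i ≡ (j , x) → proj₁ E j ≡ x
  edge-inPart (e , _ , _ , inPart) i vi≡jx
    with j′ , vi≡ ← inPart i
    with refl , refl ← ,-injective (trans (sym vi≡jx) vi≡) = refl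

  edge-samePart : ∀ {H : PartiteGraph k n} {v} → IsEdge H v →
    ∀ {i i′ j x x′} → v i ≡ (j , x) → v i′ ≡ (j , x′) → x ≡ x′
  edge-samePart E {i} {i′} p q = trans (sym (edge-inPart E i p)) (edge-inPart E i′ q)

module Arithmetic where

  open import Data.Nat using (zero; suc; _+_; _*_; _^_; _≤_; NonZero; >-nonZero)
  open import Data.Nat.DivMod using (_/_; _%_; m≡m%n+[m/n]*n; m%n<n; m≥n⇒m/n>0)
  open import Data.Nat.Properties
    using (*-commutativeSemigroup; ^-monoˡ-≤; ^-monoʳ-≤; *-monoˡ-≤; +-monoˡ-≤; <⇒≤; m≤n*m; module ≤-Reasoning)
  open import Data.Nat.Tactic.RingSolver using (solve-∀)
  open import Relation.Binary.PropositionalEquality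
  open import Algebra.Properties.CommutativeSemigroup *-commutativeSemigroup using (interchange)

  ^-distribʳ-* : ∀ m n e → (m * n) ^ e ≡ m ^ e * n ^ e
  ^-distribʳ-* m n zero = refl
  ^-distribʳ-* m n (suc e) = trans (cong (m * n *_) (^-distribʳ-* m n e)) (interchange m n (m ^ e) (n ^ e))

  m^e≤c^k*n^e : ∀ {m n e} c k .{{_ : NonZero c}} → m ≤ c * n → e ≤ k → m ^ e ≤ c ^ k * n ^ e
  m^e≤c^k*n^e {m} {n} {e} c k m≤cn e≤k = begin
    m ^ e          ≤⟨ ^-monoˡ-≤ e m≤cn ⟩
    (c * n) ^ e    ≡⟨ ^-distribʳ-* c n e ⟩
    c ^ e * n ^ e  ≤⟨ *-monoˡ-≤ (n ^ e) (^-monoʳ-≤ c e≤k) ⟩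
    c ^ k * n ^ e  ∎
    where open ≤-Reasoning

  m≤2*n*[m/n] : ∀ m n .{{_ : NonZero n}} → n ≤ m → m ≤ 2 * n * (m / n)
  m≤2*n*[m/n] m n n≤m = begin
    m                      ≡⟨ m≡m%n+[m/n]*n m n ⟩
    m % n + m / n * n      ≤⟨ +-monoˡ-≤ (m / n * n) (<⇒≤ (m%n<n m n)) ⟩
    n + m / n * n          ≤⟨ +-monoˡ-≤ (m / n * n) (m≤n*m n (m / n) {{>-nonZero (m≥n⇒m/n>0 n≤m)}}) ⟩
    m / n * n + m / n * n  ≡⟨ double (m / n) n ⟩
    2 * n * (m / n)        ∎
    where
    open ≤-Reasoning
    double : ∀ q n → q * n + q * n ≡ 2 * n * q
    double = solve-∀

  [1+k*q]*d≤q*[[1+k]*d] : ∀ k d q → 1 ≤ q → suc (k * q) * d ≤ q * (suc k * d)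
  [1+k*q]*d≤q*[[1+k]*d] k d q 1≤q = begin
    d + k * q * d      ≤⟨ +-monoˡ-≤ (k * q * d) (m≤n*m d q {{>-nonZero 1≤q}}) ⟩
    q * d + k * q * d  ≡⟨ regroup q k d ⟩
    q * (suc k * d)    ∎
    where
    open ≤-Reasoning
    regroup : ∀ q k d → q * d + k * q * d ≡ q * (suc k * d)
    regroup = solve-∀

module SpaceBarrier where

  open Counting
  open ToℚBounds
  open PartiteGraphs
  open Arithmetic
  open import Data.Bool using (Bool; true; false; T; not; _∧_; _∨_; if_then_else_)
  open import Data.Bool.ListAction using (all; any)
  open import Data.Bool.Properties using (T-∧; T-∨; T-≡; T-not-≡)
  open import Data.Empty using (⊥-elim)
  open import Data.Fin using (Fin; zero; suc; toℕ; fromℕ<; inject≤; combine; _≟_)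
  open import Data.Fin.Properties
    using ( toℕ<n; toℕ-inject≤; toℕ-fromℕ<; toℕ-injective; combine-injective; inject≤-injective
          ; any?; all?; ¬∀⟶∃¬; injective⇒≤)
  open import Data.Fin.Subset using (Subset; ∣_∣)
  open import Data.Fin.Subset.Properties using (∣p∣≤∣x∷p∣)
  open import Data.List using (allFin; map)
  open import Data.List.Properties using (map-cong)
  open import Data.List.Relation.Unary.All.Properties as All using (all⁺; all⁻)
  open import Data.List.Relation.Unary.Any.Properties as Any using (any⁺; any⁻)
  open import Data.Nat as ℕ using (ℕ; zero; suc; _*_; _^_; _∸_; _≤_; _<_; _<ᵇ_; NonZero)
  open import Data.Nat.ListAction using (product)
  open import Data.Nat.Properties
    using ( <ᵇ⇒<; <⇒<ᵇ; ≤-<-trans; <⇒≱; *-monoˡ-≤; *-monoʳ-≤; ^-monoˡ-≤; m≤n*m; n≤1+n; m∸n≤m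
          ; *-commutativeSemigroup; module ≤-Reasoning)
  open import Data.Product using (∃; _×_; _,_; proj₁; proj₂)
  open import Data.Rational as ℚ using (1ℚ; 0ℚ; ↧ₙ_)
  open import Data.Sum using (inj₁; inj₂)
  open import Data.Vec using (lookup; _∷_)
  open import Data.Vec.Functional using (updateAt)
  open import Data.Vec.Functional.Properties using (updateAt-updates; updateAt-minimal)
  open import Function using (_∘_; const; Equivalence)
  open import Relation.Binary.PropositionalEquality
  open import Relation.Nullary using (¬_; yes; no)
  open import Relation.Nullary.Decidable using (⌊_⌋; T?)
  open import Algebra.Properties.CommutativeSemigroup *-commutativeSemigroup using (xy∙z≈xz∙y)

  private
    variable
      k n : ℕ

  -- Parts are indexed by Fin (suc k): A is the first a vertices of part zero and B the first
  -- b vertices of each other part.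
  inB : ℕ → Fin (suc k) × Fin n → Bool
  inB b (zero , v) = false
  inB b (suc j , v) = toℕ v <ᵇ b

  spaceBarrier : (a b : ℕ) → PartiteGraph (suc k) n
  spaceBarrier {k} a b e = not (toℕ (e zero) <ᵇ a) ∨ any (λ j → inB b (suc j , e (suc j))) (allFin k)

  spaceBarrier-nonEdges : ∀ {a} b → a ≤ n → count (not ∘ spaceBarrier {k} {n} a b) ≤ a * n ^ k
  spaceBarrier-nonEdges {n} {k} {a} b a≤n = begin
    count (not ∘ spaceBarrier {k} {n} a b)
      ≤⟨ count-mono {suc k} {n} (λ e → nonEdge⇒inA (toℕ (e zero) <ᵇ a) _) ⟩
    count {suc k} {n} (λ e → (toℕ (e zero) <ᵇ a) ∧ true)
      ≡⟨ count-cons-∧ {n} {k} (λ v → toℕ v <ᵇ a) (λ _ → true) ⟩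
    tally (λ v → toℕ v <ᵇ a) (allFin n) * count {k} {n} (λ _ → true)
      ≡⟨ cong₂ _*_ (tally-<ᵇ a≤n) (count-true k n) ⟩
    a * n ^ k ∎
    where
    open ≤-Reasoning
    nonEdge⇒inA : ∀ x y → T (not (not x ∨ y)) → T (x ∧ true)
    nonEdge⇒inA true _ _ = _

  spaceBarrier-dense : ∀ {a} b {p μ} → a ≤ n → a * ↧ₙ μ ≤ n → p ℚ.≤ 1ℚ → 0ℚ ℚ.< μ →
    Dense p μ (spaceBarrier {k} {n} a b)
  spaceBarrier-dense {n} {k} {a} b {μ = μ} a≤n a*d≤n p≤1 μ>0 =
    dense-if-fewNonEdges (spaceBarrier a b) p≤1 μ>0 (begin
      count (not ∘ spaceBarrier {k} {n} a b) * ↧ₙ μ  ≤⟨ *-monoˡ-≤ (↧ₙ μ) (spaceBarrier-nonEdges {n} {k} b a≤n) ⟩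
      a * n ^ k * ↧ₙ μ                              ≡⟨ xy∙z≈xz∙y a (n ^ k) (↧ₙ μ) ⟩
      a * ↧ₙ μ * n ^ k                              ≤⟨ *-monoˡ-≤ (n ^ k) a*d≤n ⟩
      n ^ suc k                                     ≤⟨ ^-monoˡ-≤ (suc k) (m≤n*m n (suc k)) ⟩
      (suc k * n) ^ suc k                           ∎)
    where open ≤-Reasoning

  spaceBarrier-deg : ∀ a {b} → b ≤ n → (I : Subset (suc k)) → ∣ I ∣ < k → (f : Fin (suc k) → Fin n) →
    b ^ (suc k ∸ ∣ I ∣) ≤ deg (spaceBarrier a b) I f
  spaceBarrier-deg {n} {k} a {b} b≤n I@(x ∷ I′) ∣I∣<k f = begin
    b ^ (suc k ∸ ∣ I ∣)
      ≡⟨ product-1-or-b I b ⟨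
    product (map (λ i → if lookup I i then 1 else b) (allFin (suc k)))
      ≡⟨ cong product (map-cong (λ i → side-size (lookup I i) (f i)) (allFin (suc k))) ⟨
    product (map (λ i → tally (side i) (allFin n)) (allFin (suc k)))
      ≡⟨ count-box side ⟨
    count (λ e → all (λ i → side i (e i)) (allFin (suc k)))
      ≤⟨ count-mono box⊆link ⟩
    deg (spaceBarrier a b) I f ∎
    where
    open ≤-Reasoning
    side : Fin (suc k) → Fin n → Bool
    side i v = if lookup I i then ⌊ v ≟ f i ⌋ else toℕ v <ᵇ b
    side-size : ∀ c x →
      tally (λ v → if c then ⌊ v ≟ x ⌋ else toℕ v <ᵇ b) (allFin n) ≡ (if c then 1 else b)
    side-size true x = tally-≟ x
    side-size false x = tally-<ᵇ b≤n
    onI : ∀ c {x y} → T (if c then x else y) → T (not c ∨ x)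
    onI true t = t
    onI false _ = _
    offI : ∀ {c x y} → c ≡ false → T (if c then x else y) → T y
    offI refl t = t
    box⊆link : ∀ e → T (all (λ i → side i (e i)) (allFin (suc k))) →
      T (spaceBarrier a b e ∧ all (λ i → not (lookup I i) ∨ ⌊ e i ≟ f i ⌋) (allFin (suc k)))
    box⊆link e inBox = Equivalence.from T-∧ (isEdge , agrees)
      where
      sides : ∀ i → T (side i (e i))
      sides = All.tabulate⁻ (all⁺ _ (allFin (suc k)) inBox)
      isEdge : T (spaceBarrier a b e)
      isEdge with j , Ij≡false ← subset-misses I′ (≤-<-trans (∣p∣≤∣x∷p∣ x I′) ∣I∣<k) =
        Equivalence.from T-∨ (inj₂ (any⁺ _ (Any.tabulate⁺ j (offI Ij≡false (sides (suc j))))))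
      agrees : T (all (λ i → not (lookup I i) ∨ ⌊ e i ≟ f i ⌋) (allFin (suc k)))
      agrees = all⁻ _ (All.tabulate⁺ (λ i → onI (lookup I i) (sides i)))

  spaceBarrier-codeg : ∀ {ℓ b} a c .{{_ : NonZero c}} → ℓ < k → b ≤ n → n ≤ c * b →
    MinCodegAtLeast ℓ (1/suc (c ^ suc k) ℚ.* toℚ (n ^ (suc k ∸ ℓ))) (spaceBarrier {k} {n} a b)
  spaceBarrier-codeg {k} {n} {b = b} a c ℓ<k b≤n n≤cb I refl f = 1/suc*toℚ≤toℚ (c ^ suc k) (begin
    n ^ e                         ≤⟨ m^e≤c^k*n^e c (suc k) n≤cb (m∸n≤m (suc k) ∣ I ∣) ⟩
    c ^ suc k * b ^ e             ≤⟨ *-monoˡ-≤ (b ^ e) (n≤1+n (c ^ suc k)) ⟩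
    suc (c ^ suc k) * b ^ e       ≤⟨ *-monoʳ-≤ (suc (c ^ suc k)) (spaceBarrier-deg a b≤n I ℓ<k f) ⟩
    suc (c ^ suc k) * deg (spaceBarrier a b) I f ∎)
    where
    open ≤-Reasoning
    e = suc k ∸ ∣ I ∣

  spaceBarrier-edge-meetsB : ∀ {a b} {v : Fin (suc k) → Fin (suc k) × Fin n} → IsEdge (spaceBarrier a b) v →
    ∀ i₀ {x} → v i₀ ≡ (zero , x) → toℕ x < a → ∃ λ i → T (inB b (v i))
  spaceBarrier-edge-meetsB {k} {a = a} {b} E@(e , isEdge , covers , _) i₀ vi₀≡ x<a
    with Equivalence.to T-∨ (Equivalence.from T-≡ isEdge)
  ... | inj₁ e₀∉A = ⊥-elim (subst T (Equivalence.to T-not-≡ e₀∉A) e₀∈A)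
    where
    e₀∈A : T (toℕ (e zero) <ᵇ a)
    e₀∈A = subst (λ y → T (toℕ y <ᵇ a)) (sym (edge-inPart E i₀ vi₀≡)) (<⇒<ᵇ x<a)
  ... | inj₂ meetsB
    with j , ej∈B ← Any.tabulate⁻ (any⁻ _ (allFin k) meetsB)
    with i , vi≡ ← covers (suc j) = i , subst (T ∘ inB b) (sym vi≡) ej∈B

  -- If no class lies inside B, choose in each class a vertex outside B, except the given
  -- vertex of A in its own class: these span a non-edge.
  copy-classInB : ∀ {m a b} {φ : Fin (suc k) × Fin m → Fin (suc k) × Fin n} →
    IsCopyOfK m (spaceBarrier a b) φ →
    ∀ {u x} → φ u ≡ (zero , x) → toℕ x < a → ∃ λ i → ∀ y → T (inB b (φ (i , y)))
  copy-classInB {m = m} {b = b} {φ} copy {i₀ , x₀} φu≡ x<a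
    with any? (λ i → all? (λ y → T? (inB b (φ (i , y)))))
  ... | yes classInB = classInB
  ... | no noClassInB = ⊥-elim (avoidsB (proj₁ meetsB) (proj₂ meetsB))
    where
    escape : ∀ i → ∃ λ y → ¬ T (inB b (φ (i , y)))
    escape i = ¬∀⟶∃¬ m _ (λ y → T? (inB b (φ (i , y)))) (λ inB-all → noClassInB (i , inB-all))
    t : Fin (suc _) → Fin m
    t = updateAt (proj₁ ∘ escape) i₀ (const x₀)
    φti₀≡ : φ (i₀ , t i₀) ≡ (zero , _)
    φti₀≡ = trans (cong (λ y → φ (i₀ , y)) (updateAt-updates i₀ (proj₁ ∘ escape))) φu≡
    meetsB : ∃ λ i → T (inB b (φ (i , t i)))
    meetsB = spaceBarrier-edge-meetsB (copy t) i₀ φti₀≡ x<a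
    avoidsB : ∀ i → ¬ T (inB b (φ (i , t i)))
    avoidsB i with i ≟ i₀
    ... | yes refl = subst (λ w → ¬ T (inB b w)) (sym φti₀≡) (λ ())
    ... | no i≢i₀ =
      subst (λ y → ¬ T (inB b (φ (i , y)))) (sym (updateAt-minimal i i₀ (proj₁ ∘ escape) i≢i₀)) (proj₂ (escape i))

  encodeB : ∀ {b} (w : Fin (suc k) × Fin n) → T (inB b w) → Fin (k * b)
  encodeB {b = b} (suc j , v) v<b = combine j (fromℕ< (<ᵇ⇒< (toℕ v) b v<b))

  encodeB-injective : ∀ {b} (w w′ : Fin (suc k) × Fin n) (p : T (inB b w)) (p′ : T (inB b w′)) →
    encodeB w p ≡ encodeB w′ p′ → w ≡ w′
  encodeB-injective (suc j , v) (suc j′ , v′) p p′ eq with refl , v≡v′ ← combine-injective j _ j′ _ eq =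
    cong (suc j ,_) (toℕ-injective (trans (sym (toℕ-fromℕ< _)) (trans (cong toℕ v≡v′) (toℕ-fromℕ< _))))

  -- The vertex of A at slot (i₀ , y) of its copy is sent to slot (i , y) of the same copy,
  -- where class i lies inside B. Two vertices of A at slots with the same y in one copy lie
  -- on a common edge and in one part, so they coincide; hence the map is injective.
  spaceBarrier-noFactor : ∀ m {a b} → a ≤ n → k * b < a → ¬ HasKFactor m (spaceBarrier {k} {n} a b)
  spaceBarrier-noFactor {n} {k} m {a} {b} a≤n kb<a (r , φ , copies , disjoint , covers) =
    <⇒≱ kb<a (injective⇒≤ code-injective)
    where
    vertexA : Fin a → Fin n
    vertexA x = inject≤ x a≤n
    vertexA∈A : ∀ x → toℕ (vertexA x) < a
    vertexA∈A x = subst (_< a) (sym (toℕ-inject≤ x a≤n)) (toℕ<n x)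
    copyOf : Fin a → Fin r
    copyOf x = proj₁ (covers (zero , vertexA x))
    slotOf : Fin a → Fin (suc k) × Fin m
    slotOf x = proj₁ (proj₂ (covers (zero , vertexA x)))
    slotOf-≡ : ∀ x → φ (copyOf x) (slotOf x) ≡ (zero , vertexA x)
    slotOf-≡ x = proj₂ (proj₂ (covers (zero , vertexA x)))
    classInB : ∀ x → ∃ λ i → ∀ y → T (inB b (φ (copyOf x) (i , y)))
    classInB x = copy-classInB {b = b} {φ (copyOf x)} (copies (copyOf x)) (slotOf-≡ x) (vertexA∈A x)
    partner : Fin a → Fin (suc k) × Fin n
    partner x = φ (copyOf x) (proj₁ (classInB x) , proj₂ (slotOf x))
    code : Fin a → Fin (k * b)
    code x = encodeB (partner x) (proj₂ (classInB x) (proj₂ (slotOf x)))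
    sameColumn : ∀ {t t′ u u′ v v′} → t ≡ t′ → proj₂ u ≡ proj₂ u′ →
      φ t u ≡ (zero , v) → φ t′ u′ ≡ (zero , v′) → v ≡ v′
    sameColumn {t} {u = _ , y} refl refl = edge-samePart (copies t (const y))
    code-injective : ∀ {x y} → code x ≡ code y → x ≡ y
    code-injective {x} {y} eq
      with copy≡ , slot≡ ← disjoint _ _ _ _ (encodeB-injective (partner x) (partner y) _ _ eq) =
      inject≤-injective a≤n a≤n x y (sameColumn copy≡ (cong proj₂ slot≡) (slotOf-≡ x) (slotOf-≡ y))

open import Data.Nat using (ℕ; _≤_; _∸_; _^_)
open import Data.Rational using (ℚ; 0ℚ; 1ℚ; _<_; _*_)
import Data.Rational as Q
open import Data.Product using (Σ; _×_)
open import Relation.Nullary using (¬_)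

open Arithmetic using (m≤2*n*[m/n]; [1+k*q]*d≤q*[[1+k]*d])
open ToℚBounds using (1/suc; 1/suc-pos)
open SpaceBarrier using (spaceBarrier; spaceBarrier-dense; spaceBarrier-codeg; spaceBarrier-noFactor)
open import Data.Nat as ℕ using (zero; suc; s≤s)
open import Data.Nat.DivMod using (_/_; m/n*n≤m; m≥n⇒m/n>0)
import Data.Nat.Properties as ℕ
open import Data.Product using (_,_)
import Data.Rational.Properties as Q

theorem1p3 : (p μ : ℚ) → 0ℚ < p → p < 1ℚ → 0ℚ < μ →
    (k ℓ m : ℕ) → 3 ≤ k → 1 ≤ ℓ → ℓ ≤ k ∸ 2 → 2 ≤ m →
    Σ ℕ λ n₀ → Σ ℚ λ α → 0ℚ < α ×
      ((n : ℕ) → n₀ ≤ n →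
        Σ (PartiteGraph k n) λ H →
          Dense p μ H
          × MinCodegAtLeast ℓ (α * toℚ (n ^ (k ∸ ℓ))) H
          × ¬ HasKFactor m H)
theorem1p3 p μ _ p<1 μ>0 k@(suc (suc k₂)) ℓ m _ _ ℓ≤k₂ _ = c , 1/suc M , 1/suc-pos M , spaceBarrierOfSize
  where
  d = Q.↧ₙ μ
  c = k ℕ.* d
  M = (2 ℕ.* c) ^ k
  spaceBarrierOfSize : (n : ℕ) → c ≤ n → Σ (PartiteGraph k n) λ H →
    Dense p μ H × MinCodegAtLeast ℓ (1/suc M * toℚ (n ^ (k ∸ ℓ))) H × ¬ HasKFactor m H
  spaceBarrierOfSize n c≤n =
    spaceBarrier a b ,
    spaceBarrier-dense b a≤n a*d≤n (Q.<⇒≤ p<1) μ>0 ,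
    spaceBarrier-codeg a (2 ℕ.* c) (s≤s ℓ≤k₂) b≤n (m≤2*n*[m/n] n c c≤n) ,
    spaceBarrier-noFactor m a≤n (ℕ.n<1+n _)
    where
    b = n / c
    a = suc (suc k₂ ℕ.* b)
    a*d≤n : a ℕ.* d ≤ n
    a*d≤n = ℕ.≤-trans ([1+k*q]*d≤q*[[1+k]*d] (suc k₂) d b (m≥n⇒m/n>0 c≤n)) (m/n*n≤m n c)
    a≤n : a ≤ n
    a≤n = ℕ.≤-trans (ℕ.m≤m*n a d) a*d≤n
    b≤n : b ≤ n
    b≤n = ℕ.≤-trans (ℕ.m≤m*n b c) (m/n*n≤m n c)
theorem1p3 _ _ _ _ _ zero _ _ () _ _ _
theorem1p3 _ _ _ _ _ (suc zero) _ _ (s≤s ()) _ _ _
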